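{- For every integer $k\ge 1$, the set $E_{2^k}$ can be partitioned into subsets $A_1,\dots,A_{2^k}$ and the set $O_{2^k}$ can be partitioned into subsets $B_1,\dots,B_{2^k}$ such that every subcube $S$ of $Q_{2^k}$ of dimension $2^{k-1}+1$ satisfies $V(S)\cap A_j\neq\emptyset$ and $V(S)\cap B_j\neq\emptyset$ for each $j\in\{1,\dots,2^k\}$, where $V(S)$ is the vertex set of $S$.
   Context: $Q_n$ is the hypercube graph on $\{0,1\}^n$. $E_n$ denotes the set of vectors in $\{0,1\}^n$ with an even number of $1$'s and $O_n$ the set with an odd number of $1$'s. A $d$-dimensional subcube of $Q_n$ is obtained by choosing $n-d$ coordinates and fixed values in $\{0,1\}$ for them, and taking all $2^d$ vectors agreeing with these fixed values. -}

module Defs where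

open import Data.Nat using (ℕ; zero; suc; _+_)
open import Data.Bool using (Bool; true; false)
open import Data.Maybe using (Maybe; just; nothing)
open import Data.Fin using (Fin)
open import Data.Vec using (Vec; lookup; count)
open import Data.Nat.DivMod using (_%_)
open import Data.Product using (Σ; _×_)
open import Relation.Binary.PropositionalEquality using (_≡_; refl)
open import Data.Bool.Properties using (T?)
open import Relation.Nullary.Decidable using (Dec; yes; no)

-- Vertices of the hypercube Q_n: 0/1-vectors of length n (false = 0, true = 1).
Vertex : ℕ → Set
Vertex n = Vec Bool n

ones : ∀ {n} → Vertex n → ℕ
ones v = count (λ b → T? b) v

InE : ∀ {n} → Vertex n → Set
InE v = ones v % 2 ≡ 0

InO : ∀ {n} → Vertex n → Set
InO v = ones v % 2 ≡ 1

-- A subcube of Q_n: each coordinate is either fixed to a value (just b)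
-- or free (nothing).
Subcube : ℕ → Set
Subcube n = Vec (Maybe Bool) n

isNothing? : (x : Maybe Bool) → Dec (x ≡ nothing)
isNothing? nothing = yes refl
isNothing? (just _) = no (λ ())

dim : ∀ {n} → Subcube n → ℕ
dim S = count isNothing? S

_∈V_ : ∀ {n} → Vertex n → Subcube n → Set
_∈V_ {n} v S = (i : Fin n) (b : Bool) → lookup S i ≡ just b → lookup v i ≡ b

IsPartitionOf : ∀ {n m} → (Vertex n → Set) → (Fin m → Vertex n → Set) → Set
IsPartitionOf {n} {m} P A =
  ((j : Fin m) (v : Vertex n) → A j v → P v) ×
  ((v : Vertex n) → P v → Σ (Fin m) (λ j → A j v × ((j' : Fin m) → A j' v → j' ≡ j)))

-- Split a vertex of Q_{2^(k+1)} into halves v = (l, r) and define its syndrome recursively by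
-- syn v = (parity r, syn l ⊕ syn r) ∈ {0,1}^(k+1); the parts A_j and B_j are the syndrome
-- classes of the even and of the odd vertices. A subcube of dimension 2^k + 1 is a product of
-- subcubes of the two halves, one of dimension at least 2^(k-1) + 1 and the other of dimension
-- at least 1. By induction the first meets every (syndrome, parity) class and the second has
-- vertices of both parities; as syndrome and parity of (l, r) are affine in each half, a vertex
-- of one half can be chosen to correct any class reached in the other.
module Submission where

open import Defs
open import Data.Nat using (ℕ; _≤_; _^_; _+_; _∸_)
open import Data.Fin using (Fin)
open import Data.Product using (Σ; _×_)
open import Relation.Binary.PropositionalEquality using (_≡_)

open import Data.Bool using (Bool; true; false; _xor_; if_then_else_)
open import Data.Bool.Properties using (xor-assoc; xor-same; xor-identityʳ)
open import Data.Fin using (zero; combine)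
open import Data.Fin.Properties using (2↔Bool; combine-surjective)
open import Data.Maybe using (Maybe; just; nothing)
open import Data.Nat using (zero; suc; _*_; _<_; _%_; z<s; ⌊_/2⌋; ⌈_/2⌉)
open import Data.Nat.DivMod using (%-distribˡ-+)
open import Data.Nat.Properties
open import Data.Product using (∃; _,_; proj₁; proj₂)
open import Data.Sum using (_⊎_; inj₁; inj₂)
open import Data.Vec using (Vec; []; _∷_; _++_; take; drop; cast; zipWith; lookup)
open import Data.Vec.Properties using (take++drop≡id; ++-injective; cast-is-id; cast-trans; count≤n)
open import Data.Vec.Relation.Binary.Pointwise.Inductive as Pointwise using (Pointwise; []; _∷_; ++⁺)
open import Function using (Inverse)
open import Relation.Nullary using (yes; no; contradiction)
open import Relation.Binary.PropositionalEquality
  using (refl; sym; trans; cong; cong₂; subst; subst₂; module ≡-Reasoning)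

private
  variable
    A B : Set
    k m n : ℕ

xor-cancelʳ : ∀ x y → (x xor y) xor y ≡ x
xor-cancelʳ x y = begin
  (x xor y) xor y ≡⟨ xor-assoc x y y ⟩
  x xor (y xor y) ≡⟨ cong (x xor_) (xor-same y) ⟩
  x xor false     ≡⟨ xor-identityʳ x ⟩
  x               ∎
  where open ≡-Reasoning

xor-cancelˡ : ∀ x y → x xor (x xor y) ≡ y
xor-cancelˡ x y = trans (sym (xor-assoc x x y)) (cong (_xor y) (xor-same x))

infixl 6 _⊕_

_⊕_ : Vec Bool n → Vec Bool n → Vec Bool n
_⊕_ = zipWith _xor_

⊕-cancelʳ : (s t : Vec Bool n) → (s ⊕ t) ⊕ t ≡ s
⊕-cancelʳ []      []      = refl
⊕-cancelʳ (x ∷ s) (y ∷ t) = cong₂ _∷_ (xor-cancelʳ x y) (⊕-cancelʳ s t)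

⊕-cancelˡ : (s t : Vec Bool n) → s ⊕ (s ⊕ t) ≡ t
⊕-cancelˡ []      []      = refl
⊕-cancelˡ (x ∷ s) (y ∷ t) = cong₂ _∷_ (xor-cancelˡ x y) (⊕-cancelˡ s t)

cast-invariant : (f : ∀ {n} → Vec A n → B) (eq : m ≡ n) (v : Vec A m) → f (cast eq v) ≡ f v
cast-invariant f refl v = cong f (cast-is-id refl v)

take-drop-++ : (xs : Vec A m) (ys : Vec A n) → take m (xs ++ ys) ≡ xs × drop m (xs ++ ys) ≡ ys
take-drop-++ {m = m} xs ys = ++-injective (take m (xs ++ ys)) xs (take++drop≡id m (xs ++ ys))

infixr 5 _⧺_

-- 2 * m unfolds to m + (m + 0), hence the casts.
_⧺_ : Vec A m → Vec A m → Vec A (2 * m)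
_⧺_ {m = m} l r = l ++ cast (sym (+-identityʳ m)) r

left : ∀ m → Vec A (2 * m) → Vec A m
left m = take m

right : ∀ m → Vec A (2 * m) → Vec A m
right m v = cast (+-identityʳ m) (drop m v)

⧺-left-right : ∀ m (v : Vec A (2 * m)) → left m v ⧺ right m v ≡ v
⧺-left-right m v = begin
  take m v ++ cast (sym (+-identityʳ m)) (cast (+-identityʳ m) (drop m v))
    ≡⟨ cong (take m v ++_) (trans (cast-trans _ _ (drop m v)) (cast-is-id _ (drop m v))) ⟩
  take m v ++ drop m v
    ≡⟨ take++drop≡id m v ⟩
  v ∎
  where open ≡-Reasoning

left-⧺ : (l r : Vec A m) → left m (l ⧺ r) ≡ l
left-⧺ {m = m} l r = proj₁ (take-drop-++ l _)

right-⧺ : (l r : Vec A m) → right m (l ⧺ r) ≡ r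
right-⧺ {m = m} l r = begin
  cast (+-identityʳ m) (drop m (l ⧺ r))
    ≡⟨ cong (cast (+-identityʳ m)) (proj₂ (take-drop-++ l _)) ⟩
  cast (+-identityʳ m) (cast (sym (+-identityʳ m)) r)
    ≡⟨ trans (cast-trans _ _ r) (cast-is-id _ r) ⟩
  r ∎
  where open ≡-Reasoning

parity : Vertex n → Bool
parity []      = false
parity (b ∷ v) = b xor parity v

parity-++ : (l : Vertex m) (r : Vertex n) → parity (l ++ r) ≡ parity l xor parity r
parity-++ []      r = refl
parity-++ (b ∷ l) r = trans (cong (b xor_) (parity-++ l r)) (sym (xor-assoc b (parity l) (parity r)))

parity-⧺ : (l r : Vertex m) → parity (l ⧺ r) ≡ parity l xor parity r
parity-⧺ {m = m} l r =
  trans (parity-++ l _) (cong (parity l xor_) (cast-invariant parity (sym (+-identityʳ m)) r))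

bit : Bool → ℕ
bit b = if b then 1 else 0

[1+bit]%2≡bit[true-xor] : ∀ b → (1 + bit b) % 2 ≡ bit (true xor b)
[1+bit]%2≡bit[true-xor] false = refl
[1+bit]%2≡bit[true-xor] true  = refl

ones%2≡bit-parity : (v : Vertex n) → ones v % 2 ≡ bit (parity v)
ones%2≡bit-parity []          = refl
ones%2≡bit-parity (false ∷ v) = ones%2≡bit-parity v
ones%2≡bit-parity (true ∷ v)  = begin
  (1 + ones v) % 2         ≡⟨ %-distribˡ-+ 1 (ones v) 2 ⟩
  (1 + ones v % 2) % 2     ≡⟨ cong (λ r → (1 + r) % 2) (ones%2≡bit-parity v) ⟩
  (1 + bit (parity v)) % 2 ≡⟨ [1+bit]%2≡bit[true-xor] (parity v) ⟩
  bit (true xor parity v)  ∎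
  where open ≡-Reasoning

data _fits_ : Bool → Maybe Bool → Set where
  free  : ∀ {b} → b fits nothing
  fixed : ∀ {b} → b fits just b

infix 4 _∈_

_∈_ : Vertex n → Subcube n → Set
_∈_ = Pointwise _fits_

∈⇒∈V : {v : Vertex n} {S : Subcube n} → v ∈ S → v ∈V S
∈⇒∈V {v = v} v∈S i b S[i]≡b =
  fits-just (subst (lookup v i fits_) S[i]≡b (Pointwise.lookup v∈S i))
  where
  fits-just : ∀ {b c} → b fits just c → b ≡ c
  fits-just fixed = refl

∈-cast : (eq : m ≡ n) {v : Vertex m} {S : Subcube m} → v ∈ S → cast eq v ∈ cast eq S
∈-cast refl {v} {S} v∈S rewrite cast-is-id refl v | cast-is-id refl S = v∈S

∈-⧺ : {l r : Vertex m} {L R : Subcube m} → l ∈ L → r ∈ R → l ⧺ r ∈ L ⧺ R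
∈-⧺ {m = m} l∈L r∈R = ++⁺ l∈L (∈-cast (sym (+-identityʳ m)) r∈R)

∈-halves : ∀ m {l r : Vertex m} (S : Subcube (2 * m)) → l ∈ left m S → r ∈ right m S → l ⧺ r ∈ S
∈-halves m S l∈L r∈R = subst (_ ∈_) (⧺-left-right m S) (∈-⧺ l∈L r∈R)

∃-∈ : (S : Subcube n) → ∃ λ v → v ∈ S
∃-∈ []            = [] , []
∃-∈ (nothing ∷ S) = let v , v∈S = ∃-∈ S in false ∷ v , free ∷ v∈S
∃-∈ (just b ∷ S)  = let v , v∈S = ∃-∈ S in b ∷ v , fixed ∷ v∈S

∃-∈-parity : (S : Subcube n) → 0 < dim S → (p : Bool) → ∃ λ v → v ∈ S × parity v ≡ p
∃-∈-parity (nothing ∷ S) _ p =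
  let v , v∈S = ∃-∈ S in (p xor parity v) ∷ v , free ∷ v∈S , xor-cancelʳ p (parity v)
∃-∈-parity (just b ∷ S) 0<dim p =
  let v , v∈S , parity-v = ∃-∈-parity S 0<dim (b xor p)
  in b ∷ v , fixed ∷ v∈S , trans (cong (b xor_) parity-v) (xor-cancelˡ b p)

dim-++ : (L : Subcube m) (R : Subcube n) → dim (L ++ R) ≡ dim L + dim R
dim-++ []            R = refl
dim-++ (nothing ∷ L) R = cong suc (dim-++ L R)
dim-++ (just _ ∷ L)  R = dim-++ L R

dim-halves : ∀ m (S : Subcube (2 * m)) → dim S ≡ dim (left m S) + dim (right m S)
dim-halves m S = begin
  dim S
    ≡⟨ cong dim (sym (⧺-left-right m S)) ⟩
  dim (left m S ⧺ right m S)
    ≡⟨ dim-++ (left m S) _ ⟩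
  dim (left m S) + dim (cast (sym (+-identityʳ m)) (right m S))
    ≡⟨ cong (dim (left m S) +_) (cast-invariant dim (sym (+-identityʳ m)) (right m S)) ⟩
  dim (left m S) + dim (right m S) ∎
  where open ≡-Reasoning

syndrome : ∀ k → Vertex (2 ^ k) → Vec Bool k
syndrome zero    v = []
syndrome (suc k) v = parity r ∷ syndrome k (left (2 ^ k) v) ⊕ syndrome k r
  where r = right (2 ^ k) v

syndrome-⧺ : ∀ k (l r : Vertex (2 ^ k)) →
             syndrome (suc k) (l ⧺ r) ≡ parity r ∷ syndrome k l ⊕ syndrome k r
syndrome-⧺ k l r rewrite left-⧺ l r | right-⧺ l r = refl

MeetsAllClasses : ∀ k → Subcube (2 ^ k) → Set
MeetsAllClasses k S = (t : Vec Bool k) (p : Bool) →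
  ∃ λ v → v ∈ S × syndrome k v ≡ t × parity v ≡ p

class-⧺ : ∀ k {l r : Vertex (2 ^ k)} {t q p} →
  syndrome k l ⊕ syndrome k r ≡ t → parity r ≡ q → parity l ≡ p xor q →
  syndrome (suc k) (l ⧺ r) ≡ q ∷ t × parity (l ⧺ r) ≡ p
class-⧺ k {l} {r} {t} {q} {p} syndromes parity-r parity-l =
  trans (syndrome-⧺ k l r) (cong₂ _∷_ parity-r syndromes) ,
  (begin
    parity (l ⧺ r)         ≡⟨ parity-⧺ l r ⟩
    parity l xor parity r  ≡⟨ cong₂ _xor_ parity-l parity-r ⟩
    (p xor q) xor q        ≡⟨ xor-cancelʳ p q ⟩
    p                      ∎)
  where open ≡-Reasoning

meetsAllClasses-fromLeft : ∀ k (S : Subcube (2 ^ suc k)) →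
  MeetsAllClasses k (left (2 ^ k) S) → 0 < dim (right (2 ^ k) S) → MeetsAllClasses (suc k) S
meetsAllClasses-fromLeft k S left-meets 0<dim (q ∷ t) p =
  let r , r∈R , parity-r = ∃-∈-parity _ 0<dim q
      l , l∈L , syndrome-l , parity-l = left-meets (t ⊕ syndrome k r) (p xor q)
      syndromes = trans (cong (_⊕ syndrome k r) syndrome-l) (⊕-cancelʳ t (syndrome k r))
  in l ⧺ r , ∈-halves (2 ^ k) S l∈L r∈R , class-⧺ k syndromes parity-r parity-l

meetsAllClasses-fromRight : ∀ k (S : Subcube (2 ^ suc k)) →
  0 < dim (left (2 ^ k) S) → MeetsAllClasses k (right (2 ^ k) S) → MeetsAllClasses (suc k) S
meetsAllClasses-fromRight k S 0<dim right-meets (q ∷ t) p =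
  let l , l∈L , parity-l = ∃-∈-parity _ 0<dim (p xor q)
      r , r∈R , syndrome-r , parity-r = right-meets (syndrome k l ⊕ t) q
      syndromes = trans (cong (syndrome k l ⊕_) syndrome-r) (⊕-cancelˡ (syndrome k l) t)
  in l ⧺ r , ∈-halves (2 ^ k) S l∈L r∈R , class-⧺ k syndromes parity-r parity-l

n<m+o⇒⌊n/2⌋<m⊎⌊n/2⌋<o : ∀ {n m o} → n < m + o → ⌊ n /2⌋ < m ⊎ ⌊ n /2⌋ < o
n<m+o⇒⌊n/2⌋<m⊎⌊n/2⌋<o {n} {m} {o} n<m+o with ⌊ n /2⌋ <? m | ⌊ n /2⌋ <? o
... | yes ⌊n/2⌋<m | _           = inj₁ ⌊n/2⌋<m
... | no _        | yes ⌊n/2⌋<o = inj₂ ⌊n/2⌋<o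
... | no ⌊n/2⌋≮m  | no ⌊n/2⌋≮o  = contradiction n<m+o (≤⇒≯ (begin
  m + o              ≤⟨ +-mono-≤ (≮⇒≥ ⌊n/2⌋≮m) (≮⇒≥ ⌊n/2⌋≮o) ⟩
  ⌊ n /2⌋ + ⌊ n /2⌋  ≤⟨ +-monoʳ-≤ ⌊ n /2⌋ (⌊n/2⌋≤⌈n/2⌉ n) ⟩
  ⌊ n /2⌋ + ⌈ n /2⌉  ≡⟨ ⌊n/2⌋+⌈n/2⌉≡n n ⟩
  n                  ∎))
  where open ≤-Reasoning

m≤n⇒n<m+o⇒0<o : ∀ {m n o} → m ≤ n → n < m + o → 0 < o
m≤n⇒n<m+o⇒0<o {o = zero}  m≤n n<m+0 = contradiction (subst (_ <_) (+-identityʳ _) n<m+0) (≤⇒≯ m≤n)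
m≤n⇒n<m+o⇒0<o {o = suc o} _   _      = z<s

⌊2^[1+k]/2⌋≡2^k : ∀ k → ⌊ 2 ^ suc k /2⌋ ≡ 2 ^ k
⌊2^[1+k]/2⌋≡2^k k =
  sym (trans (n≡⌊n+n/2⌋ (2 ^ k)) (cong (λ n → ⌊ 2 ^ k + n /2⌋) (sym (+-identityʳ (2 ^ k)))))

-- ⌊ 2 ^ k /2⌋ is 2^(k-1) for k ≥ 1, and 0 for k = 0.
meetsAllClasses : ∀ k (S : Subcube (2 ^ k)) → ⌊ 2 ^ k /2⌋ < dim S → MeetsAllClasses k S
meetsAllClasses zero    S 0<dim [] p =
  let v , v∈S , parity-v = ∃-∈-parity S 0<dim p in v , v∈S , refl , parity-v
meetsAllClasses (suc k) S large = fromLargerHalf (n<m+o⇒⌊n/2⌋<m⊎⌊n/2⌋<o 2^k<dimL+dimR)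
  where
  L = left (2 ^ k) S
  R = right (2 ^ k) S

  2^k<dimL+dimR : 2 ^ k < dim L + dim R
  2^k<dimL+dimR = subst₂ _<_ (⌊2^[1+k]/2⌋≡2^k k) (dim-halves (2 ^ k) S) large

  fromLargerHalf : ⌊ 2 ^ k /2⌋ < dim L ⊎ ⌊ 2 ^ k /2⌋ < dim R → MeetsAllClasses (suc k) S
  fromLargerHalf (inj₁ large-L) =
    meetsAllClasses-fromLeft k S (meetsAllClasses k L large-L)
      (m≤n⇒n<m+o⇒0<o (count≤n isNothing? L) 2^k<dimL+dimR)
  fromLargerHalf (inj₂ large-R) =
    meetsAllClasses-fromRight k S
      (m≤n⇒n<m+o⇒0<o (count≤n isNothing? R) (subst (2 ^ k <_) (+-comm (dim L) (dim R)) 2^k<dimL+dimR))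
      (meetsAllClasses k R large-R)

class-representative : ∀ k (S : Subcube (2 ^ suc k)) → dim S ≡ 2 ^ k + 1 →
  (t : Vec Bool (suc k)) (p : Bool) → ∃ λ v → v ∈V S × ones v % 2 ≡ bit p × syndrome (suc k) v ≡ t
class-representative k S dim-S t p =
  let v , v∈S , syndrome-v , parity-v = meetsAllClasses (suc k) S ⌊2^[1+k]/2⌋<dimS t p
  in v , ∈⇒∈V v∈S , trans (ones%2≡bit-parity v) (cong bit parity-v) , syndrome-v
  where
  ⌊2^[1+k]/2⌋<dimS : ⌊ 2 ^ suc k /2⌋ < dim S
  ⌊2^[1+k]/2⌋<dimS =
    subst₂ _<_ (sym (⌊2^[1+k]/2⌋≡2^k k)) (trans (+-comm 1 (2 ^ k)) (sym dim-S)) (n<1+n (2 ^ k))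

index : Vec Bool k → Fin (2 ^ k)
index []      = zero
index (b ∷ t) = combine (Inverse.from 2↔Bool b) (index t)

index-surjective : (j : Fin (2 ^ k)) → ∃ λ (t : Vec Bool k) → index t ≡ j
index-surjective {zero}  zero = [] , refl
index-surjective {suc k} j
  with i , j′ , refl ← combine-surjective {2} {2 ^ k} j
  with t , refl ← index-surjective {k} j′
  = Inverse.to 2↔Bool i ∷ t , cong (λ i → combine i (index t)) (Inverse.strictlyInverseʳ 2↔Bool i)

fibres-partition : (P : Vertex n → Set) (c : Vertex n → Fin m) →
                   IsPartitionOf P (λ j v → P v × c v ≡ j)
fibres-partition P c =
  (λ j v (Pv , _) → Pv) ,
  (λ v Pv → c v , (Pv , refl) , λ j (_ , cv≡j) → sym cv≡j)

lemma6 : (k : ℕ) → 1 ≤ k →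
    Σ (Fin (2 ^ k) → Vertex (2 ^ k) → Set) λ A →
    Σ (Fin (2 ^ k) → Vertex (2 ^ k) → Set) λ B →
      IsPartitionOf InE A × IsPartitionOf InO B ×
      ((S : Subcube (2 ^ k)) → dim S ≡ 2 ^ (k ∸ 1) + 1 → (j : Fin (2 ^ k)) →
        Σ (Vertex (2 ^ k)) (λ v → v ∈V S × A j v) ×
        Σ (Vertex (2 ^ k)) (λ v → v ∈V S × B j v))
lemma6 zero    ()
lemma6 (suc k) _ =
  (λ j v → InE v × class v ≡ j) , (λ j v → InO v × class v ≡ j) ,
  fibres-partition InE class , fibres-partition InO class , meets
  where
  class : Vertex (2 ^ suc k) → Fin (2 ^ suc k)
  class v = index (syndrome (suc k) v)

  meets : (S : Subcube (2 ^ suc k)) → dim S ≡ 2 ^ k + 1 → (j : Fin (2 ^ suc k)) →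
    Σ (Vertex (2 ^ suc k)) (λ v → v ∈V S × InE v × class v ≡ j) ×
    Σ (Vertex (2 ^ suc k)) (λ v → v ∈V S × InO v × class v ≡ j)
  meets S dim-S j with t , refl ← index-surjective {suc k} j =
    let v , v∈S , even-v , syndrome-v = class-representative k S dim-S t false
        w , w∈S , odd-w  , syndrome-w = class-representative k S dim-S t true
    in (v , v∈S , even-v , cong index syndrome-v) , (w , w∈S , odd-w , cong index syndrome-w)
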